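{- Let $n\geq 2$ and let $P$ be a convex permutomino of size $n$, placed so that the south-west corner of its minimal bounding rectangle is at $(1,1)$. Then $P$ has exactly $n-1$ reentrant points, each lying in $\{2,\dots,n\}^2$, and for each $i\in\{2,\dots,n\}$ there is exactly one reentrant point with abscissa $i$ and exactly one reentrant point with ordinate $i$; that is, the set of reentrant points forms a permutation matrix of $[n-1]$ (after translation by $(-1,-1)$).
   Context: A polyomino is a finite union of unit cells of $\mathbb{Z}\times\mathbb{Z}$ with connected interior; it is convex if all its rows and columns of cells are connected. For a polyomino $P$ without holes with $n$ rows and $n$ columns, placed with the south-west corner of its bounding rectangle at $(1,1)$, list its boundary vertices $A_1,\dots,A_{2(r+1)}$ clockwise starting from the leftmost vertex of minimal ordinate; $P$ is a permutomino (of size $n$) if $\{A_1,A_3,\dots\}$ and $\{A_2,A_4,\dots\}$ are both point sets of permutation matrices of $[n+1]$ (each has $n+1$ points in $[n+1]^2$ with pairwise distinct abscissas and pairwise distinct ordinates). A convex permutomino is a convex polyomino that is a permutomino. Encode the boundary of $P$, starting from the leftmost point of minimal ordinate and moving clockwise, as a word over unit steps $N,E,S,W$. The lattice point between two consecutive steps forming one of the factors $EN$, $SE$, $WS$, $NW$ (cyclically) is a reentrant point of $P$; those between factors $NE$, $ES$, $SW$, $WN$ are salient points. -}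

module Defs where

open import Data.Bool using (Bool; true; false)
open import Data.Nat using (ℕ)
open import Data.Integer using (ℤ; +_; _+_; _-_; _≤_)
open import Data.Product using (_×_; _,_; proj₁; proj₂; ∃-syntax)
open import Data.Sum using (_⊎_)
open import Data.List using (List; []; _∷_; length; zip; filter)
open import Data.List.Relation.Unary.All using (All)
open import Data.List.Relation.Unary.AllPairs using (AllPairs)
open import Data.List.Membership.Propositional using (_∈_)
open import Relation.Binary.PropositionalEquality using (_≡_; _≢_)
open import Relation.Nullary using (¬_)

-- Lattice points and cells.
-- A lattice point is a pair (x , y) of integers.  The cell (i , j) is
-- the unit square [i,i+1] × [j,j+1] (named by its south-west corner).

Point : Set
Point = ℤ × ℤ

Cell : Set
Cell = ℤ × ℤ

-- A (candidate) polyomino: a decidable set of cells.  Finiteness is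
-- enforced by the bounding-box hypothesis below.
Cells : Set
Cells = ℤ → ℤ → Bool

_∈P_ : Cell → Cells → Set
(x , y) ∈P P = P x y ≡ true

_∉P_ : Cell → Cells → Set
c ∉P P = ¬ (c ∈P P)

1ℤ : ℤ
1ℤ = + 1

Adj : Cell → Cell → Set
Adj (x , y) (x' , y') =
  (x' ≡ x + 1ℤ × y' ≡ y) ⊎ (x ≡ x' + 1ℤ × y' ≡ y) ⊎
  (y' ≡ y + 1ℤ × x' ≡ x) ⊎ (y ≡ y' + 1ℤ × x' ≡ x)

data CellPath (P : Cells) : Cell → Cell → Set where
  here : ∀ {c} → c ∈P P → CellPath P c c
  step : ∀ {c c' d} → c ∈P P → Adj c c' → CellPath P c' d → CellPath P c d

-- Connected interior (for a union of unit cells: edge-connectedness).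
Connected : Cells → Set
Connected P = ∀ c d → c ∈P P → d ∈P P → CellPath P c d

Convex : Cells → Set
Convex P =
  (∀ x₁ x x₂ y → (x₁ , y) ∈P P → (x₂ , y) ∈P P → x₁ ≤ x → x ≤ x₂ → (x , y) ∈P P) ×
  (∀ x y₁ y y₂ → (x , y₁) ∈P P → (x , y₂) ∈P P → y₁ ≤ y → y ≤ y₂ → (x , y) ∈P P)

-- The minimal bounding rectangle of P is [1, n+1] × [1, n+1]
-- (n columns, n rows, south-west corner at (1,1)).
BoundingBox : ℕ → Cells → Set
BoundingBox n P =
  (∀ x y → (x , y) ∈P P → (1ℤ ≤ x × x ≤ + n) × (1ℤ ≤ y × y ≤ + n)) ×
  (∃[ y ] ((1ℤ , y) ∈P P)) × (∃[ y ] ((+ n , y) ∈P P)) ×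
  (∃[ x ] ((x , 1ℤ) ∈P P)) × (∃[ x ] ((x , + n) ∈P P))

data Step : Set where
  N E S W : Step

move : Point → Step → Point
move (x , y) N = (x , y + 1ℤ)
move (x , y) E = (x + 1ℤ , y)
move (x , y) S = (x , y - 1ℤ)
move (x , y) W = (x - 1ℤ , y)

-- Vertices v₀ , … , v_{m-1} visited by the word s₀ … s_{m-1} from v₀;
-- step sᵢ goes from vᵢ to vᵢ₊₁.
vertices : Point → List Step → List Point
vertices v []       = []
vertices v (s ∷ ss) = v ∷ vertices (move v s) ss

endpoint : Point → List Step → Point
endpoint v []       = v
endpoint v (s ∷ ss) = endpoint (move v s) ss

-- The step (x,y) --s--> is a unit edge of the boundary of P traversed
-- clockwise, i.e. with the interior of P on its right.
BoundaryEdge : Cells → Point → Step → Set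
BoundaryEdge P (x , y) N = ((x , y) ∈P P) × ((x - 1ℤ , y) ∉P P)
BoundaryEdge P (x , y) E = ((x , y - 1ℤ) ∈P P) × ((x , y) ∉P P)
BoundaryEdge P (x , y) S = ((x - 1ℤ , y - 1ℤ) ∈P P) × ((x , y - 1ℤ) ∉P P)
BoundaryEdge P (x , y) W = ((x - 1ℤ , y) ∈P P) × ((x - 1ℤ , y - 1ℤ) ∉P P)

IsBoundaryWord : Cells → Point → List Step → Set
IsBoundaryWord P v₀ w =
  endpoint v₀ w ≡ v₀ ×
  All (λ e → BoundaryEdge P (proj₁ e) (proj₂ e)) (zip (vertices v₀ w) w) ×
  AllPairs _≢_ (vertices v₀ w) ×
  (∀ v s → BoundaryEdge P v s → (v , s) ∈ zip (vertices v₀ w) w) ×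
  All (λ v → proj₂ v₀ ≤ proj₂ v × (proj₂ v ≡ proj₂ v₀ → proj₁ v₀ ≤ proj₁ v))
      (vertices v₀ w)

-- Cyclic reading: for w = s₀ … s_{m-1}, the vertex vᵢ lies between the
-- steps s_{i-1} (indices mod m) and sᵢ.

lastOf : Step → List Step → Step
lastOf s []       = s
lastOf s (t ∷ ts) = lastOf t ts

dropLast : Step → List Step → List Step
dropLast s []       = []
dropLast s (t ∷ ts) = s ∷ dropLast t ts

prevSteps : List Step → List Step
prevSteps []       = []
prevSteps (s ∷ ss) = lastOf s ss ∷ dropLast s ss

turns : Point → List Step → List (Point × Step × Step)
turns v₀ w = zip (vertices v₀ w) (zip (prevSteps w) w)

isCorner : Step → Step → Bool
isCorner N N = false
isCorner E E = false
isCorner S S = false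
isCorner W W = false
isCorner _ _ = true

isReentrant : Step → Step → Bool
isReentrant E N = true
isReentrant S E = true
isReentrant W S = true
isReentrant N W = true
isReentrant _ _ = false

selectBy : (Step → Step → Bool) → List (Point × Step × Step) → List Point
selectBy f [] = []
selectBy f ((v , p , s) ∷ ts) with f p s
... | true  = v ∷ selectBy f ts
... | false = selectBy f ts

boundaryVertices : Point → List Step → List Point
boundaryVertices v₀ w = selectBy isCorner (turns v₀ w)

reentrantPoints : Point → List Step → List Point
reentrantPoints v₀ w = selectBy isReentrant (turns v₀ w)

oddPos : List Point → List Point
evenPos : List Point → List Point
oddPos []       = []
oddPos (a ∷ as) = a ∷ evenPos as
evenPos []       = []
evenPos (a ∷ as) = oddPos as

IsPermutationMatrix : ℕ → List Point → Set
IsPermutationMatrix k ps =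
  length ps ≡ k ×
  All (λ p → (1ℤ ≤ proj₁ p × proj₁ p ≤ + k) × (1ℤ ≤ proj₂ p × proj₂ p ≤ + k)) ps ×
  AllPairs (λ p q → proj₁ p ≢ proj₁ q × proj₂ p ≢ proj₂ q) ps

IsPermutomino : ℕ → Point → List Step → Set
IsPermutomino n v₀ w =
  IsPermutationMatrix (ℕ.suc n) (oddPos (boundaryVertices v₀ w)) ×
  IsPermutationMatrix (ℕ.suc n) (evenPos (boundaryVertices v₀ w))

-- Cut the clockwise boundary word into its maximal straight runs, the sides of P. Consecutive
-- sides are perpendicular and the word starts with a north step, so the odd-indexed boundary
-- vertices are the starting corners of the vertical sides and the even-indexed ones those of the
-- horizontal sides; the permutomino condition therefore puts exactly one vertical side on each
-- abscissa and one horizontal side on each ordinate in {1, …, n+1}. A side off the border of the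
-- bounding box has exactly one reentrant end: two reentrant ends contradict the convexity of the
-- adjacent column (row), and with two salient ends every edge-path from the far border of the
-- bounding box would have to cross the side, contradicting connectedness. Every reentrant point
-- lies in {2, …, n}² and is an end of a vertical and of a horizontal side, so each abscissa and
-- each ordinate in {2, …, n} carries exactly one reentrant point.

module Submission where

open import Defs
open import Data.Nat using (ℕ; _∸_)
import Data.Nat as ℕ
import Data.Nat.Properties as ℕ
open import Data.Integer using (ℤ; +_; -[1+_]; _+_; _-_; -_; _≤_; _<_; +≤+; +<+; _≟_)
import Data.Integer.Properties as ℤ
open import Data.Integer.Tactic.RingSolver using (solve-∀)
open import Data.Bool using (Bool; true; false)
import Data.Bool as Bool
open import Data.Product using (_×_; _,_; proj₁; proj₂; ∃-syntax)
open import Data.Sum using (_⊎_; inj₁; inj₂)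
open import Data.Empty using (⊥-elim)
open import Data.Unit using (⊤)
open import Data.List using (List; []; _∷_; length; filter; map; zip; applyUpTo)
import Data.List.Properties as List
open import Data.List.Relation.Unary.All using (All; []; _∷_; lookup; tabulate)
import Data.List.Relation.Unary.All as All
open import Data.List.Relation.Unary.Any using (Any; here; there)
import Data.List.Relation.Unary.Any as Any
open import Data.List.Relation.Unary.AllPairs as AllPairs using ([]; _∷_)
import Data.List.Relation.Unary.AllPairs.Properties as AllPairsₚ
open import Data.List.Relation.Unary.Unique.Propositional using (Unique)
import Data.List.Relation.Unary.Unique.Propositional.Properties as Unique
open import Data.List.Relation.Binary.Subset.Propositional using (_⊆_)
open import Data.List.Membership.Propositional using (_∈_)
open import Data.List.Membership.Propositional.Properties
  using (∈-map⁺; ∈-map⁻; ∈-filter⁺; ∈-filter⁻; ∈-applyUpTo⁺; ∈-applyUpTo⁻)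
open import Function using (_∘_)
open import Relation.Binary.Definitions using (DecidableEquality)
open import Relation.Binary.PropositionalEquality
  using (_≡_; _≢_; refl; sym; trans; cong; subst; module ≡-Reasoning)
open import Relation.Nullary using (¬_; yes; no)
open import Relation.Nullary.Decidable using (¬?)
open import Relation.Unary using (Decidable)

x+1-1≡x : ∀ x → (x + 1ℤ) - 1ℤ ≡ x
x+1-1≡x = solve-∀

x-1+1≡x : ∀ x → (x - 1ℤ) + 1ℤ ≡ x
x-1+1≡x = solve-∀

i<i+1 : ∀ i → i < i + 1ℤ
i<i+1 i = ℤ.suc[i]≤j⇒i<j (ℤ.≤-reflexive (ℤ.+-comm 1ℤ i))

i-1<i : ∀ i → i - 1ℤ < i
i-1<i i = subst (i - 1ℤ <_) (x-1+1≡x i) (i<i+1 (i - 1ℤ))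

i-1≤i : ∀ i → i - 1ℤ ≤ i
i-1≤i i = ℤ.<⇒≤ (i-1<i i)

i<j⇒i+1≤j : ∀ {i j} → i < j → i + 1ℤ ≤ j
i<j⇒i+1≤j {i} i<j = subst (_≤ _) (ℤ.+-comm 1ℤ i) (ℤ.i<j⇒suc[i]≤j i<j)

i+1≤j⇒i<j : ∀ {i j} → i + 1ℤ ≤ j → i < j
i+1≤j⇒i<j {i} i+1≤j = ℤ.suc[i]≤j⇒i<j (subst (_≤ _) (ℤ.+-comm i 1ℤ) i+1≤j)

i<j⇒i≤j-1 : ∀ {i j} → i < j → i ≤ j - 1ℤ
i<j⇒i≤j-1 {i} i<j = subst (_≤ _) (x+1-1≡x i) (ℤ.+-monoˡ-≤ (- 1ℤ) (i<j⇒i+1≤j i<j))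

i<j+1⇒i≤j : ∀ {i j} → i < j + 1ℤ → i ≤ j
i<j+1⇒i≤j {i} {j} i<j+1 = subst (i ≤_) (x+1-1≡x j) (i<j⇒i≤j-1 i<j+1)

≤-<-connex : ∀ i j → i ≤ j ⊎ j < i
≤-<-connex i j with i ℤ.≤? j
... | yes i≤j = inj₁ i≤j
... | no i≰j = inj₂ (ℤ.≰⇒> i≰j)

≤⇒≡⊎< : ∀ {i j} → i ≤ j → i ≡ j ⊎ i < j
≤⇒≡⊎< {i} {j} i≤j with i ≟ j
... | yes i≡j = inj₁ i≡j
... | no i≢j = inj₂ (ℤ.≤∧≢⇒< i≤j i≢j)

interval-cons : ∀ (Q : ℤ → Set) {lo hi} → Q lo → (∀ i → lo + 1ℤ ≤ i → i < hi → Q i) →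
                ∀ i → lo ≤ i → i < hi → Q i
interval-cons Q Q-lo Q-rest i lo≤i i<hi with ≤⇒≡⊎< lo≤i
... | inj₁ refl = Q-lo
... | inj₂ lo<i = Q-rest i (i<j⇒i+1≤j lo<i) i<hi

interval-snoc : ∀ (Q : ℤ → Set) {lo hi} → Q (hi - 1ℤ) → (∀ i → lo ≤ i → i < hi - 1ℤ → Q i) →
                ∀ i → lo ≤ i → i < hi → Q i
interval-snoc Q Q-top Q-rest i lo≤i i<hi with ≤⇒≡⊎< (i<j⇒i≤j-1 i<hi)
... | inj₁ refl = Q-top
... | inj₂ i<hi-1 = Q-rest i lo≤i i<hi-1

2≤i⇒1≤i-1 : ∀ {i} → + 2 ≤ i → 1ℤ ≤ i - 1ℤ
2≤i⇒1≤i-1 2≤i = i<j⇒i≤j-1 (i+1≤j⇒i<j 2≤i)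

i≤j⇒i-1<j : ∀ {i j} → i ≤ j → i - 1ℤ < j
i≤j⇒i-1<j {i} i≤j = ℤ.<-≤-trans (i-1<i i) i≤j

i≤j⇒i-1≤j-1 : ∀ {i j} → i ≤ j → i - 1ℤ ≤ j - 1ℤ
i≤j⇒i-1≤j-1 = ℤ.+-monoˡ-≤ (- 1ℤ)

1≤i-1⇒2≤i : ∀ {i} → 1ℤ ≤ i - 1ℤ → + 2 ≤ i
1≤i-1⇒2≤i {i} 1≤i-1 = subst (+ 2 ≤_) (x-1+1≡x i) (ℤ.+-monoˡ-≤ 1ℤ 1≤i-1)

module _ {A : Set} (_≟A_ : DecidableEquality A) where

  open import Data.List.Membership.DecPropositional _≟A_ using (_∈?_)

  length-mono-⊆ : ∀ {xs ys : List A} → Unique xs → xs ⊆ ys → length xs ℕ.≤ length ys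
  length-mono-⊆ {[]} _ _ = ℕ.z≤n
  length-mono-⊆ {x ∷ xs} {ys} (x∉xs ∷ xs!) x∷xs⊆ys =
    ℕ.≤-<-trans (length-mono-⊆ xs! xs⊆ys-x) (List.filter-notAll (≢x? x) ys x∈ys)
    where
    ≢x? : ∀ x → Decidable (_≢ x)
    ≢x? x y = ¬? (y ≟A x)
    xs⊆ys-x : xs ⊆ filter (≢x? x) ys
    xs⊆ys-x y∈xs = ∈-filter⁺ (≢x? x) (x∷xs⊆ys (there y∈xs)) (λ y≡x → lookup x∉xs y∈xs (sym y≡x))
    x∈ys : Any (λ y → ¬ (y ≢ x)) ys
    x∈ys = Any.map (λ { refl y≢y → y≢y refl }) (x∷xs⊆ys (here refl))

  ⊆-length-≥⇒⊇ : ∀ {xs ys : List A} → Unique xs → xs ⊆ ys → length ys ℕ.≤ length xs → ys ⊆ xs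
  ⊆-length-≥⇒⊇ {xs} {ys} xs! xs⊆ys |ys|≤|xs| {y} y∈ys with y ∈? xs
  ... | yes y∈xs = y∈xs
  ... | no y∉xs = ⊥-elim (ℕ.<-irrefl refl (ℕ.≤-trans |y∷xs|≤|ys| |ys|≤|xs|))
    where
    y∷xs! : Unique (y ∷ xs)
    y∷xs! = tabulate (λ z∈xs y≡z → y∉xs (subst (_∈ xs) (sym y≡z) z∈xs)) ∷ xs!
    |y∷xs|≤|ys| : length (y ∷ xs) ℕ.≤ length ys
    |y∷xs|≤|ys| = length-mono-⊆ y∷xs! λ { (here refl) → y∈ys ; (there z∈xs) → xs⊆ys z∈xs }

  ⊆-antisym⇒length-≡ : ∀ {xs ys : List A} → Unique xs → Unique ys → xs ⊆ ys → ys ⊆ xs →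
                        length xs ≡ length ys
  ⊆-antisym⇒length-≡ xs! ys! xs⊆ys ys⊆xs = ℕ.≤-antisym (length-mono-⊆ xs! xs⊆ys) (length-mono-⊆ ys! ys⊆xs)

module _ {A B : Set} (f : A → B) where

  map-Unique-injectiveOn : ∀ {xs} → Unique xs → (∀ {x y} → x ∈ xs → y ∈ xs → f x ≡ f y → x ≡ y) →
                           Unique (map f xs)
  map-Unique-injectiveOn {[]} [] _ = []
  map-Unique-injectiveOn {x ∷ xs} (x∉xs ∷ xs!) inj =
    tabulate fx∉fxs ∷ map-Unique-injectiveOn xs! (λ x∈ y∈ → inj (there x∈) (there y∈))
    where
    fx∉fxs : ∀ {z} → z ∈ map f xs → f x ≢ z
    fx∉fxs z∈ fx≡z with y , y∈xs , refl ← ∈-map⁻ f z∈ = lookup x∉xs y∈xs (inj (here refl) (there y∈xs) fx≡z)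

  Unique-map⇒injectiveOn : ∀ {xs} → Unique (map f xs) → ∀ {x y} → x ∈ xs → y ∈ xs → f x ≡ f y → x ≡ y
  Unique-map⇒injectiveOn (_ ∷ _) (here refl) (here refl) _ = refl
  Unique-map⇒injectiveOn (fx∉ ∷ _) (here refl) (there y∈) fx≡fy = ⊥-elim (lookup fx∉ (∈-map⁺ f y∈) fx≡fy)
  Unique-map⇒injectiveOn (fy∉ ∷ _) (there x∈) (here refl) fx≡fy = ⊥-elim (lookup fy∉ (∈-map⁺ f x∈) (sym fx≡fy))
  Unique-map⇒injectiveOn (_ ∷ fxs!) (there x∈) (there y∈) fx≡fy = Unique-map⇒injectiveOn fxs! x∈ y∈ fx≡fy

length-filter≡1 : ∀ {A : Set} {P : A → Set} (P? : Decidable P) {xs} → Unique xs →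
                  (∀ {x y} → x ∈ xs → y ∈ xs → P x → P y → x ≡ y) → ∃[ x ] (x ∈ xs × P x) →
                  length (filter P? xs) ≡ 1
length-filter≡1 P? {x ∷ xs} (x∉xs ∷ xs!) unique (y , y∈ , Py) with P? x
... | yes Px = cong (ℕ.suc ∘ length) (List.filter-none P? (tabulate λ z∈xs Pz →
                 lookup x∉xs z∈xs (unique (here refl) (there z∈xs) Px Pz)))
... | no ¬Px with y∈
...   | here refl = ⊥-elim (¬Px Py)
...   | there y∈xs = length-filter≡1 P? xs! (λ a∈ b∈ → unique (there a∈) (there b∈)) (y , y∈xs , Py)

∈-zip⁻₁ : ∀ {A B : Set} {a : A} {b : B} xs ys → (a , b) ∈ zip xs ys → a ∈ xs
∈-zip⁻₁ (x ∷ xs) (y ∷ ys) (here refl) = here refl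
∈-zip⁻₁ (x ∷ xs) (y ∷ ys) (there ab∈) = there (∈-zip⁻₁ xs ys ab∈)

interval : ℕ → ℕ → List ℤ
interval a m = applyUpTo (λ i → + (a ℕ.+ i)) m

∈-interval⁺ : ∀ {a m z} → + a ≤ z → z < + (a ℕ.+ m) → z ∈ interval a m
∈-interval⁺ {a} {m} {+ k} (+≤+ a≤k) (+<+ k<a+m) =
  subst (_∈ interval a m) (cong +_ (ℕ.m+[n∸m]≡n a≤k))
        (∈-applyUpTo⁺ (λ i → + (a ℕ.+ i)) (ℕ.+-cancelˡ-< a _ _ (subst (ℕ._< a ℕ.+ m) (sym (ℕ.m+[n∸m]≡n a≤k)) k<a+m)))

∈-interval⁻ : ∀ {a m z} → z ∈ interval a m → + a ≤ z × z < + (a ℕ.+ m)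
∈-interval⁻ {a} {m} z∈ with i , i<m , refl ← ∈-applyUpTo⁻ (λ i → + (a ℕ.+ i)) z∈ =
  +≤+ (ℕ.m≤m+n a i) , +<+ (ℕ.+-monoʳ-< a i<m)

interval-Unique : ∀ a m → Unique (interval a m)
interval-Unique a m = Unique.applyUpTo⁺₁ _ m (λ i<j _ eq → ℕ.<-irrefl (ℕ.+-cancelˡ-≡ a _ _ (ℤ.+-injective eq)) i<j)

length-interval : ∀ a m → length (interval a m) ≡ m
length-interval a m = List.length-applyUpTo _ m

Turn : Set
Turn = Point × Step × Step

TurnBy : (Step → Step → Bool) → Turn → Set
TurnBy f (_ , a , b) = f a b ≡ true

turnBy? : ∀ f → Decidable (TurnBy f)
turnBy? f (_ , a , b) = f a b Bool.≟ true

selectBy-filter : ∀ f ts → selectBy f ts ≡ map proj₁ (filter (turnBy? f) ts)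
selectBy-filter f [] = refl
selectBy-filter f ((v , a , b) ∷ ts) with f a b
... | true = cong (v ∷_) (selectBy-filter f ts)
... | false = selectBy-filter f ts

∈-selectBy⁻ : ∀ f ts {v} → v ∈ selectBy f ts → ∃[ a ] ∃[ b ] ((v , a , b) ∈ ts × f a b ≡ true)
∈-selectBy⁻ f ts v∈ rewrite selectBy-filter f ts
  with (_ , a , b) , t∈ , refl ← ∈-map⁻ proj₁ v∈ = a , b , ∈-filter⁻ (turnBy? f) t∈

∈-selectBy⁺ : ∀ f ts {v a b} → (v , a , b) ∈ ts → f a b ≡ true → v ∈ selectBy f ts
∈-selectBy⁺ f ts t∈ fab rewrite selectBy-filter f ts = ∈-map⁺ proj₁ (∈-filter⁺ (turnBy? f) t∈ fab)

selectBy-Unique : ∀ f ts → Unique (map proj₁ ts) → Unique (selectBy f ts)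
selectBy-Unique f ts vs! rewrite selectBy-filter f ts =
  AllPairsₚ.map⁺ (AllPairsₚ.filter⁺ (turnBy? f) (AllPairsₚ.map⁻ vs!))

selectBy-accept : ∀ f {v a b} ts → f a b ≡ true → selectBy f ((v , a , b) ∷ ts) ≡ v ∷ selectBy f ts
selectBy-accept f {a = a} {b} ts fab with f a b
selectBy-accept f ts refl | true = refl

data Axis : Set where
  vertical horizontal : Axis

axis : Step → Axis
axis N = vertical
axis S = vertical
axis E = horizontal
axis W = horizontal

flip : Axis → Axis
flip vertical = horizontal
flip horizontal = vertical

flip-involutive : ∀ a → flip (flip a) ≡ a
flip-involutive vertical = refl
flip-involutive horizontal = refl

coord : Axis → Point → ℤ
coord vertical = proj₁
coord horizontal = proj₂

flip-≢ : ∀ x → flip x ≢ x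
flip-≢ vertical ()
flip-≢ horizontal ()

axis-or-flip : ∀ y x → y ≡ x ⊎ flip y ≡ x
axis-or-flip vertical vertical = inj₁ refl
axis-or-flip vertical horizontal = inj₂ refl
axis-or-flip horizontal vertical = inj₂ refl
axis-or-flip horizontal horizontal = inj₁ refl

Alternating : {A : Set} → (A → Axis) → Axis → List A → Set
Alternating f x [] = ⊤
Alternating f x (y ∷ ys) = f y ≡ x × Alternating f (flip x) ys

module _ {A : Set} (pt : A → Point) (lbl : A → Axis) where

  ∈-oddPos⁻ : ∀ {x ys p} → Alternating lbl x ys → p ∈ oddPos (map pt ys) →
              ∃[ y ] (y ∈ ys × pt y ≡ p × lbl y ≡ x)
  ∈-evenPos⁻ : ∀ {x ys p} → Alternating lbl x ys → p ∈ evenPos (map pt ys) →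
               ∃[ y ] (y ∈ ys × pt y ≡ p × lbl y ≡ flip x)
  ∈-oddPos⁻ {ys = y ∷ _} (ly≡x , _) (here refl) = y , here refl , refl , ly≡x
  ∈-oddPos⁻ {x} {_ ∷ _} (_ , alt) (there p∈)
    with z , z∈ , refl , lz≡ ← ∈-evenPos⁻ alt p∈ = z , there z∈ , refl , trans lz≡ (flip-involutive x)
  ∈-evenPos⁻ {ys = _ ∷ _} (_ , alt) p∈ with z , z∈ , refl , lz≡ ← ∈-oddPos⁻ alt p∈ = z , there z∈ , refl , lz≡

  ∈-oddPos⁺ : ∀ {x ys y} → Alternating lbl x ys → y ∈ ys → lbl y ≡ x → pt y ∈ oddPos (map pt ys)
  ∈-evenPos⁺ : ∀ {x ys y} → Alternating lbl x ys → y ∈ ys → lbl y ≡ flip x → pt y ∈ evenPos (map pt ys)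
  ∈-oddPos⁺ _ (here refl) _ = here refl
  ∈-oddPos⁺ {x} (_ , alt) (there y∈) ly≡x = there (∈-evenPos⁺ alt y∈ (trans ly≡x (sym (flip-involutive x))))
  ∈-evenPos⁺ {x} (ly≡x , _) (here refl) ly≡flipx = ⊥-elim (flip-≢ x (trans (sym ly≡flipx) ly≡x))
  ∈-evenPos⁺ (_ , alt) (there y∈) ly≡flipx = ∈-oddPos⁺ alt y∈ ly≡flipx

coord-≢ : ∀ x {p q : Point} → proj₁ p ≢ proj₁ q × proj₂ p ≢ proj₂ q → coord x p ≢ coord x q
coord-≢ vertical = proj₁
coord-≢ horizontal = proj₂

module _ {k : ℕ} {ps : List Point} (perm : IsPermutationMatrix k ps) where

  permutation-coords-Unique : ∀ x → Unique (map (coord x) ps)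
  permutation-coords-Unique x = AllPairsₚ.map⁺ (AllPairs.map (coord-≢ x) (proj₂ (proj₂ perm)))

  permutation-coord-injective : ∀ x {p q} → p ∈ ps → q ∈ ps → coord x p ≡ coord x q → p ≡ q
  permutation-coord-injective x = Unique-map⇒injectiveOn (coord x) (permutation-coords-Unique x)

  permutation-coord-range : ∀ x {p} → p ∈ ps → 1ℤ ≤ coord x p × coord x p ≤ + k
  permutation-coord-range vertical p∈ = proj₁ (lookup (proj₁ (proj₂ perm)) p∈)
  permutation-coord-range horizontal p∈ = proj₂ (lookup (proj₁ (proj₂ perm)) p∈)

  interval⊆permutation-coords : ∀ x → interval 1 k ⊆ map (coord x) ps
  interval⊆permutation-coords x = ⊆-length-≥⇒⊇ ℤ._≟_ (permutation-coords-Unique x) coords⊆interval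
    (ℕ.≤-reflexive (trans (length-interval 1 k) (trans (sym (proj₁ perm)) (sym (List.length-map (coord x) ps)))))
    where
    coords⊆interval : map (coord x) ps ⊆ interval 1 k
    coords⊆interval c∈ with p , p∈ , refl ← ∈-map⁻ (coord x) c∈ =
      ∈-interval⁺ (proj₁ (permutation-coord-range x p∈))
                  (ℤ.≤-<-trans (proj₂ (permutation-coord-range x p∈)) (+<+ (ℕ.n<1+n k)))

  permutation-covers : ∀ x i → 1 ℕ.≤ i → i ℕ.≤ k → ∃[ p ] (p ∈ ps × coord x p ≡ + i)
  permutation-covers x i 1≤i i≤k
    with p , p∈ , i≡ ← ∈-map⁻ (coord x) (interval⊆permutation-coords x (∈-interval⁺ (+≤+ 1≤i) (+<+ (ℕ.s≤s i≤k))))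
    = p , p∈ , sym i≡

InnerPoint : ℕ → Point → Set
InnerPoint n p = (+ 2 ≤ proj₁ p × proj₁ p ≤ + n) × (+ 2 ≤ proj₂ p × proj₂ p ≤ + n)

InnerPoint-coord : ∀ {n p} x → InnerPoint n p → + 2 ≤ coord x p × coord x p ≤ + n
InnerPoint-coord vertical = proj₁
InnerPoint-coord horizontal = proj₂

-- Boundary edges and straight runs

∈P-cong : ∀ {P : Cells} {x y x′ y′} → x ≡ x′ → y ≡ y′ → (x , y) ∈P P → (x′ , y′) ∈P P
∈P-cong refl refl c∈P = c∈P

ArrivingEdge : Cells → Point → Step → Set
ArrivingEdge P (x , y) N = ((x , y - 1ℤ) ∈P P) × ((x - 1ℤ , y - 1ℤ) ∉P P)
ArrivingEdge P (x , y) E = ((x - 1ℤ , y - 1ℤ) ∈P P) × ((x - 1ℤ , y) ∉P P)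
ArrivingEdge P (x , y) S = ((x - 1ℤ , y) ∈P P) × ((x , y) ∉P P)
ArrivingEdge P (x , y) W = ((x , y) ∈P P) × ((x , y - 1ℤ) ∉P P)

BoundaryEdge⇒ArrivingEdge : ∀ {P} u d → BoundaryEdge P u d → ArrivingEdge P (move u d) d
BoundaryEdge⇒ArrivingEdge {P} (x , y) N (c∈ , c∉) =
  ∈P-cong {P} refl (sym (x+1-1≡x y)) c∈ , c∉ ∘ ∈P-cong {P} refl (x+1-1≡x y)
BoundaryEdge⇒ArrivingEdge {P} (x , y) E (c∈ , c∉) =
  ∈P-cong {P} (sym (x+1-1≡x x)) refl c∈ , c∉ ∘ ∈P-cong {P} (x+1-1≡x x) refl
BoundaryEdge⇒ArrivingEdge (x , y) S e = e
BoundaryEdge⇒ArrivingEdge (x , y) W e = e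

data Straight (P : Cells) : Point → Step → Point → Set where
  edge : ∀ {u d} → BoundaryEdge P u d → Straight P u d (move u d)
  _∷_  : ∀ {u d v} → BoundaryEdge P u d → Straight P (move u d) d v → Straight P u d v

Straight-head : ∀ {P u d v} → Straight P u d v → BoundaryEdge P u d
Straight-head (edge e) = e
Straight-head (e ∷ _) = e

Straight-arrives : ∀ {P u d v} → Straight P u d v → ArrivingEdge P v d
Straight-arrives {u = u} {d} (edge e) = BoundaryEdge⇒ArrivingEdge u d e
Straight-arrives (_ ∷ s) = Straight-arrives s

Straight-snoc : ∀ {P u d v} → Straight P u d v → BoundaryEdge P v d → Straight P u d (move v d)
Straight-snoc (edge e) e′ = e ∷ edge e′
Straight-snoc (e ∷ s) e′ = e ∷ Straight-snoc s e′

module _ {P : Cells} where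

  Straight-N : ∀ {x y₁ v} → Straight P (x , y₁) N v → proj₁ v ≡ x × y₁ < proj₂ v ×
               (∀ y → y₁ ≤ y → y < proj₂ v → BoundaryEdge P (x , y) N)
  Straight-N {x} {y₁} (edge e) =
    refl , i<i+1 y₁ ,
    interval-cons (λ y → BoundaryEdge P (x , y) N) e (λ y y₁+1≤y y<y₁+1 → ⊥-elim (ℤ.<⇒≱ y<y₁+1 y₁+1≤y))
  Straight-N {x} {y₁} (e ∷ s) with refl , y₁+1<y₂ , along ← Straight-N s =
    refl , ℤ.<-trans (i<i+1 y₁) y₁+1<y₂ , interval-cons (λ y → BoundaryEdge P (x , y) N) e along

  Straight-E : ∀ {x₁ y v} → Straight P (x₁ , y) E v → proj₂ v ≡ y × x₁ < proj₁ v ×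
               (∀ x → x₁ ≤ x → x < proj₁ v → BoundaryEdge P (x , y) E)
  Straight-E {x₁} {y} (edge e) =
    refl , i<i+1 x₁ ,
    interval-cons (λ x → BoundaryEdge P (x , y) E) e (λ x x₁+1≤x x<x₁+1 → ⊥-elim (ℤ.<⇒≱ x<x₁+1 x₁+1≤x))
  Straight-E {x₁} {y} (e ∷ s) with refl , x₁+1<x₂ , along ← Straight-E s =
    refl , ℤ.<-trans (i<i+1 x₁) x₁+1<x₂ , interval-cons (λ x → BoundaryEdge P (x , y) E) e along

  Straight-S : ∀ {x y₁ v} → Straight P (x , y₁) S v → proj₁ v ≡ x × proj₂ v < y₁ ×
               (∀ y → proj₂ v ≤ y → y < y₁ → ArrivingEdge P (x , y) S)
  Straight-S {x} {y₁} (edge e) =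
    refl , i-1<i y₁ ,
    interval-snoc (λ y → ArrivingEdge P (x , y) S) e (λ y y₁-1≤y y<y₁-1 → ⊥-elim (ℤ.<⇒≱ y<y₁-1 y₁-1≤y))
  Straight-S {x} {y₁} (e ∷ s) with refl , y₂<y₁-1 , along ← Straight-S s =
    refl , ℤ.<-trans y₂<y₁-1 (i-1<i y₁) , interval-snoc (λ y → ArrivingEdge P (x , y) S) e along

  Straight-W : ∀ {x₁ y v} → Straight P (x₁ , y) W v → proj₂ v ≡ y × proj₁ v < x₁ ×
               (∀ x → proj₁ v ≤ x → x < x₁ → ArrivingEdge P (x , y) W)
  Straight-W {x₁} {y} (edge e) =
    refl , i-1<i x₁ ,
    interval-snoc (λ x → ArrivingEdge P (x , y) W) e (λ x x₁-1≤x x<x₁-1 → ⊥-elim (ℤ.<⇒≱ x<x₁-1 x₁-1≤x))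
  Straight-W {x₁} {y} (e ∷ s) with refl , x₂<x₁-1 , along ← Straight-W s =
    refl , ℤ.<-trans x₂<x₁-1 (i-1<i x₁) , interval-snoc (λ x → ArrivingEdge P (x , y) W) e along

  CellPath-start : ∀ {c d} → CellPath P c d → c ∈P P
  CellPath-start (here c∈P) = c∈P
  CellPath-start (step c∈P _ _) = c∈P

  CellPath-crosses-column : ∀ {c d} → CellPath P c d → ∀ k → proj₁ c ≤ k → k < proj₁ d →
                            ∃[ y ] (((k , y) ∈P P) × ((k + 1ℤ , y) ∈P P))
  CellPath-crosses-column (here _) k x≤k k<x = ⊥-elim (ℤ.<⇒≱ k<x x≤k)
  CellPath-crosses-column (step {x , y} {x′ , y′} c∈P adj p) k x≤k k<d with ≤-<-connex x′ k
  ... | inj₁ x′≤k = CellPath-crosses-column p k x′≤k k<d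
  ... | inj₂ k<x′ with adj
  ... | inj₁ (refl , refl) with refl ← ℤ.≤-antisym x≤k (i<j+1⇒i≤j k<x′) = y , c∈P , CellPath-start p
  ... | inj₂ (inj₁ (refl , _)) = ⊥-elim (ℤ.<⇒≱ (ℤ.<-trans k<x′ (i<i+1 x′)) x≤k)
  ... | inj₂ (inj₂ (inj₁ (_ , refl))) = ⊥-elim (ℤ.<⇒≱ k<x′ x≤k)
  ... | inj₂ (inj₂ (inj₂ (_ , refl))) = ⊥-elim (ℤ.<⇒≱ k<x′ x≤k)

  CellPath-crosses-row : ∀ {c d} → CellPath P c d → ∀ k → proj₂ c ≤ k → k < proj₂ d →
                         ∃[ x ] (((x , k) ∈P P) × ((x , k + 1ℤ) ∈P P))
  CellPath-crosses-row (here _) k y≤k k<y = ⊥-elim (ℤ.<⇒≱ k<y y≤k)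
  CellPath-crosses-row (step {x , y} {x′ , y′} c∈P adj p) k y≤k k<d with ≤-<-connex y′ k
  ... | inj₁ y′≤k = CellPath-crosses-row p k y′≤k k<d
  ... | inj₂ k<y′ with adj
  ... | inj₁ (_ , refl) = ⊥-elim (ℤ.<⇒≱ k<y′ y≤k)
  ... | inj₂ (inj₁ (_ , refl)) = ⊥-elim (ℤ.<⇒≱ k<y′ y≤k)
  ... | inj₂ (inj₂ (inj₁ (refl , refl))) with refl ← ℤ.≤-antisym y≤k (i<j+1⇒i≤j k<y′) = x , c∈P , CellPath-start p
  ... | inj₂ (inj₂ (inj₂ (refl , _))) = ⊥-elim (ℤ.<⇒≱ (ℤ.<-trans k<y′ (i<i+1 y′)) y≤k)

  module _ (convex : Convex P) where

    column-within : ∀ x lo hi → (x , lo) ∈P P → (x , lo - 1ℤ) ∉P P → (x , hi - 1ℤ) ∈P P → (x , hi) ∉P P →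
                    ∀ y → (x , y) ∈P P → lo ≤ y × y < hi
    column-within x lo hi lo∈ below∉ hi-1∈ hi∉ y y∈ with ≤-<-connex lo y | ≤-<-connex hi y
    ... | inj₂ y<lo | _ = ⊥-elim (below∉ (proj₂ convex x y (lo - 1ℤ) lo y∈ lo∈ (i<j⇒i≤j-1 y<lo) (i-1≤i lo)))
    ... | inj₁ _ | inj₁ hi≤y = ⊥-elim (hi∉ (proj₂ convex x (hi - 1ℤ) hi y hi-1∈ y∈ (i-1≤i hi) hi≤y))
    ... | inj₁ lo≤y | inj₂ y<hi = lo≤y , y<hi

    row-within : ∀ y lo hi → (lo , y) ∈P P → (lo - 1ℤ , y) ∉P P → (hi - 1ℤ , y) ∈P P → (hi , y) ∉P P →
                 ∀ x → (x , y) ∈P P → lo ≤ x × x < hi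
    row-within y lo hi lo∈ left∉ hi-1∈ hi∉ x x∈ with ≤-<-connex lo x | ≤-<-connex hi x
    ... | inj₂ x<lo | _ = ⊥-elim (left∉ (proj₁ convex x (lo - 1ℤ) lo y x∈ lo∈ (i<j⇒i≤j-1 x<lo) (i-1≤i lo)))
    ... | inj₁ _ | inj₁ hi≤x = ⊥-elim (hi∉ (proj₁ convex (hi - 1ℤ) hi x y hi-1∈ x∈ (i-1≤i hi) hi≤x))
    ... | inj₁ lo≤x | inj₂ x<hi = lo≤x , x<hi

Straight-coord : ∀ {P u d v} → Straight P u d v → coord (axis d) v ≡ coord (axis d) u
Straight-coord {d = N} s = proj₁ (Straight-N s)
Straight-coord {d = E} s = proj₁ (Straight-E s)
Straight-coord {d = S} s = proj₁ (Straight-S s)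
Straight-coord {d = W} s = proj₁ (Straight-W s)

module _ {n : ℕ} {P : Cells} (box : BoundingBox n P) where

  cell-bounds : ∀ {x y} → (x , y) ∈P P → (1ℤ ≤ x × x ≤ + n) × (1ℤ ≤ y × y ≤ + n)
  cell-bounds = proj₁ box _ _

  cell-in-column-1 : ∃[ y ] ((1ℤ , y) ∈P P)
  cell-in-column-1 = proj₁ (proj₂ box)

  cell-in-column-n : ∃[ y ] ((+ n , y) ∈P P)
  cell-in-column-n = proj₁ (proj₂ (proj₂ box))

  cell-in-row-1 : ∃[ x ] ((x , 1ℤ) ∈P P)
  cell-in-row-1 = proj₁ (proj₂ (proj₂ (proj₂ box)))

  cell-in-row-n : ∃[ x ] ((x , + n) ∈P P)
  cell-in-row-n = proj₂ (proj₂ (proj₂ (proj₂ box)))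

  lowest-cell-below : ∀ x z → (x , z) ∈P P → ∃[ z′ ] (z′ ≤ z × (x , z′) ∈P P × (x , z′ - 1ℤ) ∉P P)
  lowest-cell-below x -[1+ _ ] c∈ with () ← proj₁ (proj₂ (cell-bounds c∈))
  lowest-cell-below x (+ m) = lowest-from m
    where
    lowest-from : ∀ m → (x , + m) ∈P P → ∃[ z′ ] (z′ ≤ + m × (x , z′) ∈P P × (x , z′ - 1ℤ) ∉P P)
    lowest-from ℕ.zero c∈ with +≤+ () ← proj₁ (proj₂ (cell-bounds c∈))
    lowest-from (ℕ.suc m) c∈ with P x (+ m) in below
    ... | true with z′ , z′≤m , z′∈ , z′-1∉ ← lowest-from m below =
      z′ , ℤ.≤-trans z′≤m (+≤+ (ℕ.n≤1+n m)) , z′∈ , z′-1∉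
    ... | false = + ℕ.suc m , ℤ.≤-refl , c∈ , λ below∈ → true≢false (trans (sym below∈) below)
      where
      true≢false : true ≢ false
      true≢false ()

isCorner-false⇒≡ : ∀ a b → isCorner a b ≡ false → a ≡ b
isCorner-false⇒≡ N N _ = refl
isCorner-false⇒≡ E E _ = refl
isCorner-false⇒≡ S S _ = refl
isCorner-false⇒≡ W W _ = refl
isCorner-false⇒≡ N E ()
isCorner-false⇒≡ N S ()
isCorner-false⇒≡ N W ()
isCorner-false⇒≡ E N ()
isCorner-false⇒≡ E S ()
isCorner-false⇒≡ E W ()
isCorner-false⇒≡ S N ()
isCorner-false⇒≡ S E ()
isCorner-false⇒≡ S W ()
isCorner-false⇒≡ W N ()
isCorner-false⇒≡ W E ()
isCorner-false⇒≡ W S ()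

data ReentrantTurn : Step → Step → Set where
  EN : ReentrantTurn E N
  SE : ReentrantTurn S E
  WS : ReentrantTurn W S
  NW : ReentrantTurn N W

reentrantTurn : ∀ a b → isReentrant a b ≡ true → ReentrantTurn a b
reentrantTurn E N _ = EN
reentrantTurn S E _ = SE
reentrantTurn W S _ = WS
reentrantTurn N W _ = NW
reentrantTurn N N ()
reentrantTurn N E ()
reentrantTurn N S ()
reentrantTurn E E ()
reentrantTurn E S ()
reentrantTurn E W ()
reentrantTurn S N ()
reentrantTurn S S ()
reentrantTurn S W ()
reentrantTurn W N ()
reentrantTurn W E ()
reentrantTurn W W ()

ReentrantTurn⇒isCorner : ∀ {a b} → ReentrantTurn a b → isCorner a b ≡ true
ReentrantTurn⇒isCorner EN = refl
ReentrantTurn⇒isCorner SE = refl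
ReentrantTurn⇒isCorner WS = refl
ReentrantTurn⇒isCorner NW = refl

corner-flips-axis : ∀ {P} v a b → ArrivingEdge P v a → BoundaryEdge P v b → isCorner a b ≡ true →
                    axis b ≡ flip (axis a)
corner-flips-axis _ N E _ _ _ = refl
corner-flips-axis _ N W _ _ _ = refl
corner-flips-axis _ S E _ _ _ = refl
corner-flips-axis _ S W _ _ _ = refl
corner-flips-axis _ E N _ _ _ = refl
corner-flips-axis _ E S _ _ _ = refl
corner-flips-axis _ W N _ _ _ = refl
corner-flips-axis _ W S _ _ _ = refl
corner-flips-axis (_ , _) N S arr e _ = ⊥-elim (proj₂ arr (proj₁ e))
corner-flips-axis (_ , _) S N arr e _ = ⊥-elim (proj₂ arr (proj₁ e))
corner-flips-axis (_ , _) E W arr e _ = ⊥-elim (proj₂ arr (proj₁ e))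
corner-flips-axis (_ , _) W E arr e _ = ⊥-elim (proj₂ arr (proj₁ e))
corner-flips-axis _ N N _ _ ()
corner-flips-axis _ E E _ _ ()
corner-flips-axis _ S S _ _ ()
corner-flips-axis _ W W _ _ ()

reentrant-point-inner : ∀ {n P p a b} → BoundingBox n P → ReentrantTurn a b →
                        ArrivingEdge P p a → BoundaryEdge P p b → InnerPoint n p
reentrant-point-inner {p = _ , _} box EN (sw , _) (ne , _) =
  (1≤i-1⇒2≤i (proj₁ (proj₁ (cell-bounds box sw))) , proj₂ (proj₁ (cell-bounds box ne))) ,
  (1≤i-1⇒2≤i (proj₁ (proj₂ (cell-bounds box sw))) , proj₂ (proj₂ (cell-bounds box ne)))
reentrant-point-inner {p = _ , _} box SE (nw , _) (se , _) =
  (1≤i-1⇒2≤i (proj₁ (proj₁ (cell-bounds box nw))) , proj₂ (proj₁ (cell-bounds box se))) ,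
  (1≤i-1⇒2≤i (proj₁ (proj₂ (cell-bounds box se))) , proj₂ (proj₂ (cell-bounds box nw)))
reentrant-point-inner {p = _ , _} box WS (ne , _) (sw , _) =
  (1≤i-1⇒2≤i (proj₁ (proj₁ (cell-bounds box sw))) , proj₂ (proj₁ (cell-bounds box ne))) ,
  (1≤i-1⇒2≤i (proj₁ (proj₂ (cell-bounds box sw))) , proj₂ (proj₂ (cell-bounds box ne)))
reentrant-point-inner {p = _ , _} box NW (se , _) (nw , _) =
  (1≤i-1⇒2≤i (proj₁ (proj₁ (cell-bounds box nw))) , proj₂ (proj₁ (cell-bounds box se))) ,
  (1≤i-1⇒2≤i (proj₁ (proj₂ (cell-bounds box se))) , proj₂ (proj₂ (cell-bounds box nw)))

-- Sides and their reentrant ends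

record Side : Set where
  constructor side
  field
    start  : Point
    before : Step
    dir    : Step
    end    : Point
    after  : Step
open Side

record IsSide (P : Cells) (s : Side) : Set where
  constructor isSide
  field
    arrival    : ArrivingEdge P (start s) (before s)
    straight   : Straight P (start s) (dir s) (end s)
    departure  : BoundaryEdge P (end s) (after s)
    turn-start : isCorner (before s) (dir s) ≡ true
    turn-end   : isCorner (dir s) (after s) ≡ true

OneReentrantEnd : Side → Set
OneReentrantEnd s = (isReentrant (before s) (dir s) ≡ true × isReentrant (dir s) (after s) ≡ false) ⊎
                    (isReentrant (before s) (dir s) ≡ false × isReentrant (dir s) (after s) ≡ true)

ReentrantEndOf : Side → Point → Set
ReentrantEndOf r p = (p ≡ start r × isReentrant (before r) (dir r) ≡ true) ⊎
                     (p ≡ end r × isReentrant (dir r) (after r) ≡ true)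

OneReentrantEnd-unique : ∀ {r p q} → OneReentrantEnd r → ReentrantEndOf r p → ReentrantEndOf r q → p ≡ q
OneReentrantEnd-unique _ (inj₁ (refl , _)) (inj₁ (refl , _)) = refl
OneReentrantEnd-unique _ (inj₂ (refl , _)) (inj₂ (refl , _)) = refl
OneReentrantEnd-unique (inj₁ (_ , f)) (inj₁ _) (inj₂ (_ , t)) with () ← trans (sym f) t
OneReentrantEnd-unique (inj₂ (f , _)) (inj₁ (_ , t)) (inj₂ _) with () ← trans (sym f) t
OneReentrantEnd-unique (inj₁ (_ , f)) (inj₂ (_ , t)) (inj₁ _) with () ← trans (sym f) t
OneReentrantEnd-unique (inj₂ (f , _)) (inj₂ _) (inj₁ (_ , t)) with () ← trans (sym f) t

ReentrantEndOf-coord : ∀ {P r p} → IsSide P r → ReentrantEndOf r p →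
                       coord (axis (dir r)) p ≡ coord (axis (dir r)) (start r)
ReentrantEndOf-coord _ (inj₁ (refl , _)) = refl
ReentrantEndOf-coord r-side (inj₂ (refl , _)) = Straight-coord (IsSide.straight r-side)

module _ {P : Cells} (convex : Convex P) (connected : Connected P) {n : ℕ} (box : BoundingBox n P) where

  north-side : ∀ {x y₁ b v a} → + 2 ≤ x → IsSide P (side (x , y₁) b N v a) →
               OneReentrantEnd (side (x , y₁) b N v a)
  north-side {b = N} _ (isSide _ _ _ () _)
  north-side {a = N} _ (isSide _ _ _ _ ())
  north-side {b = S} _ (isSide arr s _ _ _) = ⊥-elim (proj₂ arr (proj₁ (Straight-head s)))
  north-side {a = S} _ (isSide _ s dep _ _) = ⊥-elim (proj₂ dep (proj₁ (Straight-arrives s)))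
  north-side {b = E} {a = E} _ _ = inj₁ (refl , refl)
  north-side {b = W} {a = W} _ _ = inj₂ (refl , refl)
  north-side {x} {y₁} {E} {_ , y₂} {W} _ (isSide arr s dep _ _)
    with refl , y₁<y₂ , _ ← Straight-N s =
    ⊥-elim (proj₂ arr (proj₂ convex (x - 1ℤ) (y₁ - 1ℤ) y₁ y₂ (proj₁ arr) (proj₁ dep) (i-1≤i y₁) (ℤ.<⇒≤ y₁<y₂)))
  north-side {x} {y₁} {W} {_ , y₂} {E} 2≤x (isSide arr s dep _ _)
    with refl , _ , along ← Straight-N s
       | _ , c∈ ← cell-in-column-1 box
    with y , left∈ , right∈
           ← CellPath-crosses-column (connected _ _ c∈ (proj₁ arr)) (x - 1ℤ) (2≤i⇒1≤i-1 2≤x) (i-1<i x)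
    with y₁≤y , y<y₂ ← column-within convex x y₁ y₂ (proj₁ arr) (proj₂ arr) (proj₁ dep) (proj₂ dep) y
                                     (∈P-cong {P} (x-1+1≡x x) refl right∈)
    = ⊥-elim (proj₂ (along y y₁≤y y<y₂) left∈)

  south-side : ∀ {x y₁ b v a} → x ≤ + n → IsSide P (side (x , y₁) b S v a) →
               OneReentrantEnd (side (x , y₁) b S v a)
  south-side {b = S} _ (isSide _ _ _ () _)
  south-side {a = S} _ (isSide _ _ _ _ ())
  south-side {b = N} _ (isSide arr s _ _ _) = ⊥-elim (proj₂ arr (proj₁ (Straight-head s)))
  south-side {a = N} _ (isSide _ s dep _ _) = ⊥-elim (proj₂ (Straight-arrives s) (proj₁ dep))
  south-side {b = W} {a = W} _ _ = inj₁ (refl , refl)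
  south-side {b = E} {a = E} _ _ = inj₂ (refl , refl)
  south-side {x} {y₁} {W} {_ , y₂} {E} _ (isSide arr s dep _ _)
    with refl , y₂<y₁ , _ ← Straight-S s =
    ⊥-elim (proj₂ arr (proj₂ convex x (y₂ - 1ℤ) (y₁ - 1ℤ) y₁ (proj₁ dep) (proj₁ arr)
                                    (i≤j⇒i-1≤j-1 (ℤ.<⇒≤ y₂<y₁)) (i-1≤i y₁)))
  south-side {x} {y₁} {E} {_ , y₂} {W} x≤n (isSide arr s dep _ _)
    with refl , _ , along ← Straight-S s
       | _ , c∈ ← cell-in-column-n box
    with y , left∈ , right∈
           ← CellPath-crosses-column (connected _ _ (proj₁ dep) c∈) (x - 1ℤ) ℤ.≤-refl (i≤j⇒i-1<j x≤n)
    with y₂≤y , y<y₁ ← column-within convex (x - 1ℤ) y₂ y₁ (proj₁ dep) (proj₂ dep) (proj₁ arr) (proj₂ arr) y left∈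
    = ⊥-elim (proj₂ (along y y₂≤y y<y₁) (∈P-cong {P} (x-1+1≡x x) refl right∈))

  east-side : ∀ {x₁ y b v a} → y ≤ + n → IsSide P (side (x₁ , y) b E v a) →
              OneReentrantEnd (side (x₁ , y) b E v a)
  east-side {b = E} _ (isSide _ _ _ () _)
  east-side {a = E} _ (isSide _ _ _ _ ())
  east-side {b = W} _ (isSide arr s _ _ _) = ⊥-elim (proj₂ arr (proj₁ (Straight-head s)))
  east-side {a = W} _ (isSide _ s dep _ _) = ⊥-elim (proj₂ (Straight-arrives s) (proj₁ dep))
  east-side {b = S} {a = S} _ _ = inj₁ (refl , refl)
  east-side {b = N} {a = N} _ _ = inj₂ (refl , refl)
  east-side {x₁} {y} {S} {x₂ , _} {N} _ (isSide arr s dep _ _)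
    with refl , x₁<x₂ , _ ← Straight-E s =
    ⊥-elim (proj₂ dep (proj₁ convex (x₁ - 1ℤ) (x₂ - 1ℤ) x₂ y (proj₁ arr) (proj₁ dep)
                                    (i≤j⇒i-1≤j-1 (ℤ.<⇒≤ x₁<x₂)) (i-1≤i x₂)))
  east-side {x₁} {y} {N} {x₂ , _} {S} y≤n (isSide arr s dep _ _)
    with refl , _ , along ← Straight-E s
       | _ , c∈ ← cell-in-row-n box
    with x , below∈ , above∈
           ← CellPath-crosses-row (connected _ _ (proj₁ arr) c∈) (y - 1ℤ) ℤ.≤-refl (i≤j⇒i-1<j y≤n)
    with x₁≤x , x<x₂ ← row-within convex (y - 1ℤ) x₁ x₂ (proj₁ arr) (proj₂ arr) (proj₁ dep) (proj₂ dep) x below∈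
    = ⊥-elim (proj₂ (along x x₁≤x x<x₂) (∈P-cong {P} refl (x-1+1≡x y) above∈))

  west-side : ∀ {x₁ y b v a} → + 2 ≤ y → IsSide P (side (x₁ , y) b W v a) →
              OneReentrantEnd (side (x₁ , y) b W v a)
  west-side {b = W} _ (isSide _ _ _ () _)
  west-side {a = W} _ (isSide _ _ _ _ ())
  west-side {b = E} _ (isSide arr s _ _ _) = ⊥-elim (proj₂ arr (proj₁ (Straight-head s)))
  west-side {a = E} _ (isSide _ s dep _ _) = ⊥-elim (proj₂ dep (proj₁ (Straight-arrives s)))
  west-side {b = N} {a = N} _ _ = inj₁ (refl , refl)
  west-side {b = S} {a = S} _ _ = inj₂ (refl , refl)
  west-side {x₁} {y} {N} {x₂ , _} {S} _ (isSide arr s dep _ _)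
    with refl , x₂<x₁ , _ ← Straight-W s =
    ⊥-elim (proj₂ arr (proj₁ convex (x₂ - 1ℤ) (x₁ - 1ℤ) x₁ (y - 1ℤ) (proj₁ dep) (proj₁ arr)
                                    (i≤j⇒i-1≤j-1 (ℤ.<⇒≤ x₂<x₁)) (i-1≤i x₁)))
  west-side {x₁} {y} {S} {x₂ , _} {N} 2≤y (isSide arr s dep _ _)
    with refl , _ , along ← Straight-W s
       | _ , c∈ ← cell-in-row-1 box
    with x , below∈ , above∈
           ← CellPath-crosses-row (connected _ _ c∈ (proj₁ dep)) (y - 1ℤ) (2≤i⇒1≤i-1 2≤y) (i-1<i y)
    with x₂≤x , x<x₁ ← row-within convex y x₂ x₁ (proj₁ dep) (proj₂ dep) (proj₁ arr) (proj₂ arr) x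
                                  (∈P-cong {P} refl (x-1+1≡x y) above∈)
    = ⊥-elim (proj₂ (along x x₂≤x x<x₁) below∈)

  inner-side-has-one-reentrant-end : ∀ {s} → IsSide P s →
    + 2 ≤ coord (axis (dir s)) (start s) → coord (axis (dir s)) (start s) ≤ + n → OneReentrantEnd s
  inner-side-has-one-reentrant-end {side _ _ N _ _} s-side 2≤c _ = north-side 2≤c s-side
  inner-side-has-one-reentrant-end {side _ _ S _ _} s-side _ c≤n = south-side c≤n s-side
  inner-side-has-one-reentrant-end {side _ _ E _ _} s-side _ c≤n = east-side c≤n s-side
  inner-side-has-one-reentrant-end {side _ _ W _ _} s-side 2≤c _ = west-side 2≤c s-side

turnsFrom : Point → Step → List Step → List Turn
turnsFrom v p [] = []
turnsFrom v p (s ∷ ss) = (v , p , s) ∷ turnsFrom (move v s) s ss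

zip-dropLast≡turnsFrom : ∀ v p ss → zip (vertices v ss) (zip (dropLast p ss) ss) ≡ turnsFrom v p ss
zip-dropLast≡turnsFrom v p [] = refl
zip-dropLast≡turnsFrom v p (s ∷ ss) = cong ((v , p , s) ∷_) (zip-dropLast≡turnsFrom (move v s) s ss)

turns-∷ : ∀ v s ss → turns v (s ∷ ss) ≡ (v , lastOf s ss , s) ∷ turnsFrom (move v s) s ss
turns-∷ v s ss = cong ((v , lastOf s ss , s) ∷_) (zip-dropLast≡turnsFrom (move v s) s ss)

map-proj₁-turnsFrom : ∀ v p ss → map proj₁ (turnsFrom v p ss) ≡ vertices v ss
map-proj₁-turnsFrom v p [] = refl
map-proj₁-turnsFrom v p (s ∷ ss) = cong (v ∷_) (map-proj₁-turnsFrom (move v s) s ss)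

BoundaryPath : Cells → Point → List Step → Set
BoundaryPath P v ss = All (λ e → BoundaryEdge P (proj₁ e) (proj₂ e)) (zip (vertices v ss) ss)

BoundaryPath-arrives : ∀ {P} v s ss → BoundaryPath P v (s ∷ ss) →
                       ArrivingEdge P (endpoint v (s ∷ ss)) (lastOf s ss)
BoundaryPath-arrives v s [] (e ∷ _) = BoundaryEdge⇒ArrivingEdge v s e
BoundaryPath-arrives v s (t ∷ ts) (_ ∷ es) = BoundaryPath-arrives (move v s) t ts es

last-vertex : ∀ v s ss → ∃[ u ] (u ∈ vertices v (s ∷ ss) × move u (lastOf s ss) ≡ endpoint v (s ∷ ss))
last-vertex v s [] = v , here refl , refl
last-vertex v s (t ∷ ts) with u , u∈ , u-last ← last-vertex (move v s) t ts = u , there u∈ , u-last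

second-vertex : ∀ {Q : Point → Set} v s ss → endpoint v (s ∷ ss) ≡ v → Q v → All Q (vertices v (s ∷ ss)) →
                Q (move v s)
second-vertex {Q} v s [] closed Qv _ = subst Q (sym closed) Qv
second-vertex v s (_ ∷ _) _ _ (_ ∷ Q-second ∷ _) = Q-second

module _ {n : ℕ} {P : Cells} (box : BoundingBox n P) where

  boundaryWord-starts-north : ∀ {v₀ w} → IsBoundaryWord P v₀ w → ∃[ ss ] (w ≡ N ∷ ss)
  boundaryWord-starts-north {_} {[]} (_ , _ , _ , complete , _)
    with _ , c∈ ← cell-in-column-1 box
    with () ← complete _ N (c∈ , λ c-1∈ → ℤ.<⇒≱ (i-1<i 1ℤ) (proj₁ (proj₁ (cell-bounds box c-1∈))))
  boundaryWord-starts-north {_} {N ∷ ss} _ = ss , refl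
  boundaryWord-starts-north {x₀ , y₀} {S ∷ ss} (closed , _ , _ , _ , lowest) =
    ⊥-elim (ℤ.<⇒≱ (i-1<i y₀) (proj₁ (second-vertex (x₀ , y₀) S ss closed (ℤ.≤-refl , λ _ → ℤ.≤-refl) lowest)))
  boundaryWord-starts-north {x₀ , y₀} {W ∷ ss} (closed , _ , _ , _ , lowest) =
    ⊥-elim (ℤ.<⇒≱ (i-1<i x₀) (proj₂ (second-vertex (x₀ , y₀) W ss closed (ℤ.≤-refl , λ _ → ℤ.≤-refl) lowest) refl))
  -- The bottom edge of the column of cells below v₀ would be a boundary edge lower than v₀.
  boundaryWord-starts-north {x₀ , y₀} {E ∷ ss} (_ , (first-edge ∷ _) , _ , complete , lowest)
    with z , z≤ , z∈ , z-1∉ ← lowest-cell-below box x₀ _ (proj₁ first-edge)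
    with u∈ ← ∈-zip⁻₁ (vertices _ (E ∷ ss)) (E ∷ ss)
                (complete (x₀ + 1ℤ , z) W
                  (∈P-cong {P} (sym (x+1-1≡x x₀)) refl z∈ , z-1∉ ∘ ∈P-cong {P} (x+1-1≡x x₀) refl))
    = ⊥-elim (ℤ.<⇒≱ (ℤ.≤-<-trans z≤ (i-1<i y₀)) (proj₁ (lookup lowest u∈)))

  boundaryWord-turns-at-start : ∀ {v₀ ss} → IsBoundaryWord P v₀ (N ∷ ss) → isCorner (lastOf N ss) N ≡ true
  boundaryWord-turns-at-start {x₀ , y₀} {ss} (closed , _ , _ , _ , lowest)
    with lastOf N ss | last-vertex (x₀ , y₀) N ss
  ... | N | (_ , _) , u∈ , u-last =
    ⊥-elim (ℤ.<⇒≱ (i+1≤j⇒i<j (ℤ.≤-reflexive (cong proj₂ (trans u-last closed)))) (proj₁ (lookup lowest u∈)))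
  ... | E | _ = refl
  ... | S | _ = refl
  ... | W | _ = refl

-- Decomposition of a boundary word into sides

startTurn : Side → Turn
startTurn r = start r , before r , dir r

endTurn : Side → Turn
endTurn r = end r , dir r , after r

-- The sides of the path ss from v, where the current side started at the corner c (entered by
-- the step b) in direction d and has reached v; a is the step leaving the last vertex.
sidesFrom : Point → Step → Step → Point → List Step → Step → List Side
sidesFrom c b d v [] a = side c b d v a ∷ []
sidesFrom c b d v (t ∷ ts) a with isCorner d t
... | true = side c b d v t ∷ sidesFrom v d t (move v t) ts a
... | false = sidesFrom c b d (move v t) ts a

sidesFrom-starts : ∀ c b d v ss a → map start (sidesFrom c b d v ss a) ≡ c ∷ selectBy isCorner (turnsFrom v d ss)
sidesFrom-starts c b d v [] a = refl
sidesFrom-starts c b d v (t ∷ ts) a with isCorner d t in corner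
... | true = cong (c ∷_) (sidesFrom-starts v d t (move v t) ts a)
... | false with refl ← isCorner-false⇒≡ d t corner = sidesFrom-starts c b d (move v d) ts a

sidesFrom-IsSide : ∀ {P} c b d v ss a → ArrivingEdge P c b → isCorner b d ≡ true → Straight P c d v →
                   BoundaryPath P v ss → BoundaryEdge P (endpoint v ss) a → isCorner (lastOf d ss) a ≡ true →
                   All (IsSide P) (sidesFrom c b d v ss a)
sidesFrom-IsSide c b d v [] a arr turn st [] dep turn′ = isSide arr st dep turn turn′ ∷ []
sidesFrom-IsSide c b d v (t ∷ ts) a arr turn st (e ∷ es) dep turn′ with isCorner d t in corner
... | true = isSide arr st e turn corner ∷
             sidesFrom-IsSide v d t (move v t) ts a (Straight-arrives st) corner (edge e) es dep turn′
... | false with refl ← isCorner-false⇒≡ d t corner =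
  sidesFrom-IsSide c b d (move v d) ts a arr turn (Straight-snoc st e) es dep turn′

sidesFrom-Alternating : ∀ {P} c b d v ss a → Straight P c d v → BoundaryPath P v ss →
                        Alternating (axis ∘ dir) (axis d) (sidesFrom c b d v ss a)
sidesFrom-Alternating c b d v [] a _ [] = refl , _
sidesFrom-Alternating c b d v (t ∷ ts) a st (e ∷ es) with isCorner d t in corner
... | true = refl , subst (λ x → Alternating (axis ∘ dir) x (sidesFrom v d t (move v t) ts a))
                          (corner-flips-axis v d t (Straight-arrives st) e corner)
                          (sidesFrom-Alternating v d t (move v t) ts a (edge e) es)
... | false with refl ← isCorner-false⇒≡ d t corner =
  sidesFrom-Alternating c b d (move v d) ts a (Straight-snoc st e) es

sidesFrom-first : ∀ c b d v ss a → ∃[ r ] (r ∈ sidesFrom c b d v ss a × startTurn r ≡ (c , b , d))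
sidesFrom-first c b d v [] a = _ , here refl , refl
sidesFrom-first c b d v (t ∷ ts) a with isCorner d t
... | true = _ , here refl , refl
... | false = sidesFrom-first c b d (move v t) ts a

sidesFrom-last : ∀ c b d v ss a →
                 ∃[ r ] (r ∈ sidesFrom c b d v ss a × endTurn r ≡ (endpoint v ss , lastOf d ss , a))
sidesFrom-last c b d v [] a = _ , here refl , refl
sidesFrom-last c b d v (t ∷ ts) a with isCorner d t in corner
... | true with r , r∈ , r-end ← sidesFrom-last v d t (move v t) ts a = r , there r∈ , r-end
... | false with refl ← isCorner-false⇒≡ d t corner = sidesFrom-last c b d (move v d) ts a

sidesFrom-cover : ∀ c b d v ss a {t} → t ∈ turnsFrom v d ss → TurnBy isCorner t →
                  (∃[ r ] (r ∈ sidesFrom c b d v ss a × startTurn r ≡ t)) ×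
                  (∃[ r ] (r ∈ sidesFrom c b d v ss a × endTurn r ≡ t))
sidesFrom-cover c b d v (t ∷ ts) a t∈ t-corner with isCorner d t in corner
sidesFrom-cover c b d v (t ∷ ts) a (here refl) _ | true
  with r , r∈ , r-start ← sidesFrom-first v d t (move v t) ts a = (r , there r∈ , r-start) , (_ , here refl , refl)
sidesFrom-cover c b d v (t ∷ ts) a (there t∈) t-corner | true
  with (r , r∈ , r-start) , (r′ , r′∈ , r′-end) ← sidesFrom-cover v d t (move v t) ts a t∈ t-corner =
  (r , there r∈ , r-start) , (r′ , there r′∈ , r′-end)
sidesFrom-cover c b d v (t ∷ ts) a (here refl) t-corner | false with () ← trans (sym t-corner) corner
sidesFrom-cover c b d v (t ∷ ts) a (there t∈) t-corner | false with refl ← isCorner-false⇒≡ d t corner =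
  sidesFrom-cover c b d (move v d) ts a t∈ t-corner

sidesFrom-turns : ∀ {T : List Turn} c b d v ss a → (c , b , d) ∈ T → turnsFrom v d ss ⊆ T →
                  (endpoint v ss , lastOf d ss , a) ∈ T →
                  All (λ r → startTurn r ∈ T × endTurn r ∈ T) (sidesFrom c b d v ss a)
sidesFrom-turns c b d v [] a c∈ _ last∈ = (c∈ , last∈) ∷ []
sidesFrom-turns c b d v (t ∷ ts) a c∈ ts⊆ last∈ with isCorner d t in corner
... | true = (c∈ , ts⊆ (here refl)) ∷ sidesFrom-turns v d t (move v t) ts a (ts⊆ (here refl)) (ts⊆ ∘ there) last∈
... | false with refl ← isCorner-false⇒≡ d t corner = sidesFrom-turns c b d (move v d) ts a c∈ (ts⊆ ∘ there) last∈

-- Convex permutominoes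

module ConvexPermutomino
  (n : ℕ) (1≤n : 1 ℕ.≤ n) (P : Cells) (v₀ : Point) (ss : List Step)
  (connected : Connected P) (convex : Convex P) (box : BoundingBox n P)
  (boundary : IsBoundaryWord P v₀ (N ∷ ss)) (perm : IsPermutomino n v₀ (N ∷ ss)) where

  ℓ : Step
  ℓ = lastOf N ss

  v₁ : Point
  v₁ = move v₀ N

  closed : endpoint v₁ ss ≡ v₀
  closed = proj₁ boundary

  path : BoundaryPath P v₀ (N ∷ ss)
  path = proj₁ (proj₂ boundary)

  turn₀ : isCorner ℓ N ≡ true
  turn₀ = boundaryWord-turns-at-start box boundary

  T : List Turn
  T = turns v₀ (N ∷ ss)

  T≡ : T ≡ (v₀ , ℓ , N) ∷ turnsFrom v₁ N ss
  T≡ = turns-∷ v₀ N ss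

  R : List Point
  R = reentrantPoints v₀ (N ∷ ss)

  sides : List Side
  sides = sidesFrom v₀ ℓ N v₁ ss N

  sides-IsSide : All (IsSide P) sides
  sides-IsSide = sidesFrom-IsSide v₀ ℓ N v₁ ss N
    (subst (λ v → ArrivingEdge P v ℓ) closed (BoundaryPath-arrives v₀ N ss path)) turn₀
    (edge (All.head path)) (All.tail path) (subst (λ v → BoundaryEdge P v N) (sym closed) (All.head path)) turn₀

  sides-Alternating : Alternating (axis ∘ dir) vertical sides
  sides-Alternating = sidesFrom-Alternating v₀ ℓ N v₁ ss N (edge (All.head path)) (All.tail path)

  sides-turns : All (λ r → startTurn r ∈ T × endTurn r ∈ T) sides
  sides-turns = subst (λ ts → All (λ r → startTurn r ∈ ts × endTurn r ∈ ts) sides) (sym T≡)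
                      (sidesFrom-turns v₀ ℓ N v₁ ss N (here refl) there last∈)
    where
    last∈ : (endpoint v₁ ss , ℓ , N) ∈ (v₀ , ℓ , N) ∷ turnsFrom v₁ N ss
    last∈ rewrite closed = here refl

  sides-cover : ∀ {t} → t ∈ T → TurnBy isCorner t →
                (∃[ r ] (r ∈ sides × startTurn r ≡ t)) × (∃[ r ] (r ∈ sides × endTurn r ≡ t))
  sides-cover {t} t∈ corner with subst (t ∈_) T≡ t∈
  ... | here refl with r , r∈ , r-end ← sidesFrom-last v₀ ℓ N v₁ ss N =
    sidesFrom-first v₀ ℓ N v₁ ss N , (r , r∈ , trans r-end (cong (_, ℓ , N) closed))
  ... | there t∈′ = sidesFrom-cover v₀ ℓ N v₁ ss N t∈′ corner

  corners≡starts : boundaryVertices v₀ (N ∷ ss) ≡ map start sides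
  corners≡starts = begin
    selectBy isCorner T                                   ≡⟨ cong (selectBy isCorner) T≡ ⟩
    selectBy isCorner ((v₀ , ℓ , N) ∷ turnsFrom v₁ N ss) ≡⟨ selectBy-accept isCorner _ turn₀ ⟩
    v₀ ∷ selectBy isCorner (turnsFrom v₁ N ss)           ≡⟨ sidesFrom-starts v₀ ℓ N v₁ ss N ⟨
    map start sides                                       ∎
    where open ≡-Reasoning

  vertices-Unique : Unique (map proj₁ T)
  vertices-Unique = subst Unique (sym (trans (cong (map proj₁) T≡) (cong (v₀ ∷_) (map-proj₁-turnsFrom v₁ N ss))))
                          (proj₁ (proj₂ (proj₂ boundary)))

  side-determined-by-start : ∀ {r r′} → r ∈ sides → r′ ∈ sides → start r ≡ start r′ → r ≡ r′
  side-determined-by-start = Unique-map⇒injectiveOn start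
    (subst Unique corners≡starts (selectBy-Unique isCorner T vertices-Unique))

  cornersOn : Axis → List Point
  cornersOn vertical = oddPos (boundaryVertices v₀ (N ∷ ss))
  cornersOn horizontal = evenPos (boundaryVertices v₀ (N ∷ ss))

  cornersOn-permutation : ∀ x → IsPermutationMatrix (ℕ.suc n) (cornersOn x)
  cornersOn-permutation vertical = proj₁ perm
  cornersOn-permutation horizontal = proj₂ perm

  ∈-cornersOn⁻ : ∀ x {c} → c ∈ cornersOn x → ∃[ r ] (r ∈ sides × start r ≡ c × axis (dir r) ≡ x)
  ∈-cornersOn⁻ vertical c∈ =
    ∈-oddPos⁻ start (axis ∘ dir) sides-Alternating (subst (λ cs → _ ∈ oddPos cs) corners≡starts c∈)
  ∈-cornersOn⁻ horizontal c∈ =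
    ∈-evenPos⁻ start (axis ∘ dir) sides-Alternating (subst (λ cs → _ ∈ evenPos cs) corners≡starts c∈)

  ∈-cornersOn⁺ : ∀ {r} → r ∈ sides → start r ∈ cornersOn (axis (dir r))
  ∈-cornersOn⁺ {r} r∈ with axis (dir r) in r-axis
  ... | vertical = subst (λ cs → start r ∈ oddPos cs) (sym corners≡starts)
                         (∈-oddPos⁺ start (axis ∘ dir) sides-Alternating r∈ r-axis)
  ... | horizontal = subst (λ cs → start r ∈ evenPos cs) (sym corners≡starts)
                           (∈-evenPos⁺ start (axis ∘ dir) sides-Alternating r∈ r-axis)

  side-one-reentrant-end : ∀ {r} → r ∈ sides → + 2 ≤ coord (axis (dir r)) (start r) →
                           coord (axis (dir r)) (start r) ≤ + n → OneReentrantEnd r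
  side-one-reentrant-end r∈ = inner-side-has-one-reentrant-end convex connected box (lookup sides-IsSide r∈)

  reentrant-inner : ∀ {p} → p ∈ R → InnerPoint n p
  reentrant-inner p∈ with a , b , t∈ , reentrant ← ∈-selectBy⁻ isReentrant T p∈
    with turn ← reentrantTurn a b reentrant
    with (r , r∈ , refl) , _ ← sides-cover t∈ (ReentrantTurn⇒isCorner turn)
    with isSide arrival straight _ _ _ ← lookup sides-IsSide r∈
    = reentrant-point-inner box turn arrival (Straight-head straight)

  reentrant-on-side : ∀ x {p} → p ∈ R → ∃[ r ] (r ∈ sides × axis (dir r) ≡ x × ReentrantEndOf r p)
  reentrant-on-side x p∈ with a , b , t∈ , reentrant ← ∈-selectBy⁻ isReentrant T p∈
    with (r , r∈ , refl) , (side _ _ _ _ _ , r′∈ , refl)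
           ← sides-cover t∈ (ReentrantTurn⇒isCorner (reentrantTurn a b reentrant))
    with isSide arrival straight _ corner _ ← lookup sides-IsSide r∈
    with axis-or-flip (axis a) x
  ... | inj₁ refl = _ , r′∈ , refl , inj₂ (refl , reentrant)
  ... | inj₂ refl = r , r∈ , corner-flips-axis _ a b arrival (Straight-head straight) corner , inj₁ (refl , reentrant)

  reentrants-Unique : Unique R
  reentrants-Unique = selectBy-Unique isReentrant T vertices-Unique

  reentrant-coord-injective : ∀ x {p q} → p ∈ R → q ∈ R → coord x p ≡ coord x q → p ≡ q
  reentrant-coord-injective x {p} {q} p∈ q∈ p≡q
    with rp , rp∈ , refl , p-end ← reentrant-on-side x p∈
       | rq , rq∈ , rq-axis , q-end ← reentrant-on-side x q∈
    = OneReentrantEnd-unique (side-one-reentrant-end rp∈ (proj₁ bounds) (proj₂ bounds)) p-end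
                             (subst (λ r → ReentrantEndOf r q) (sym rp≡rq) q-end)
    where
    p≡start : coord x p ≡ coord x (start rp)
    p≡start = ReentrantEndOf-coord (lookup sides-IsSide rp∈) p-end
    q≡start : coord x q ≡ coord x (start rq)
    q≡start = subst (λ y → coord y q ≡ coord y (start rq)) rq-axis
                    (ReentrantEndOf-coord (lookup sides-IsSide rq∈) q-end)
    rp≡rq : rp ≡ rq
    rp≡rq = side-determined-by-start rp∈ rq∈ (permutation-coord-injective (cornersOn-permutation x) x
      (∈-cornersOn⁺ rp∈) (subst (λ y → start rq ∈ cornersOn y) rq-axis (∈-cornersOn⁺ rq∈))
      (trans (sym p≡start) (trans p≡q q≡start)))
    bounds : + 2 ≤ coord x (start rp) × coord x (start rp) ≤ + n
    bounds = subst (λ c → + 2 ≤ c × c ≤ + n) p≡start (InnerPoint-coord x (reentrant-inner p∈))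

  reentrant-with-coord : ∀ x i → 2 ℕ.≤ i → i ℕ.≤ n → ∃[ p ] (p ∈ R × coord x p ≡ + i)
  reentrant-with-coord x i 2≤i i≤n
    with c , c∈ , c≡i ← permutation-covers (cornersOn-permutation x) x i
                                            (ℕ.≤-trans (ℕ.s≤s ℕ.z≤n) 2≤i) (ℕ.m≤n⇒m≤1+n i≤n)
    with r , r∈ , refl , refl ← ∈-cornersOn⁻ x c∈
    with side-one-reentrant-end r∈ (subst (+ 2 ≤_) (sym c≡i) (+≤+ 2≤i)) (subst (_≤ + n) (sym c≡i) (+≤+ i≤n))
  ... | inj₁ (start-reentrant , _) =
    start r , ∈-selectBy⁺ isReentrant T (proj₁ (lookup sides-turns r∈)) start-reentrant , c≡i
  ... | inj₂ (_ , end-reentrant) =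
    end r , ∈-selectBy⁺ isReentrant T (proj₂ (lookup sides-turns r∈)) end-reentrant ,
    trans (Straight-coord (IsSide.straight (lookup sides-IsSide r∈))) c≡i

  reentrants-on-line : ∀ x i → 2 ℕ.≤ i → i ℕ.≤ n → length (filter (λ p → coord x p ≟ + i) R) ≡ 1
  reentrants-on-line x i 2≤i i≤n = length-filter≡1 (λ p → coord x p ≟ + i) reentrants-Unique
    (λ p∈ q∈ p≡i q≡i → reentrant-coord-injective x p∈ q∈ (trans p≡i (sym q≡i))) (reentrant-with-coord x i 2≤i i≤n)

  reentrants-length : length R ≡ n ∸ 1
  reentrants-length = begin
    length R                    ≡⟨ List.length-map proj₁ R ⟨
    length (map proj₁ R)        ≡⟨ ⊆-antisym⇒length-≡ ℤ._≟_ abscissas-Unique (interval-Unique 2 (n ∸ 1))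
                                                      abscissas⊆interval interval⊆abscissas ⟩
    length (interval 2 (n ∸ 1)) ≡⟨ length-interval 2 (n ∸ 1) ⟩
    n ∸ 1                       ∎
    where
    open ≡-Reasoning
    2+[n∸1]≡1+n : 2 ℕ.+ (n ∸ 1) ≡ ℕ.suc n
    2+[n∸1]≡1+n = cong ℕ.suc (ℕ.m+[n∸m]≡n 1≤n)
    abscissas-Unique : Unique (map proj₁ R)
    abscissas-Unique = map-Unique-injectiveOn proj₁ reentrants-Unique (reentrant-coord-injective vertical)
    abscissas⊆interval : map proj₁ R ⊆ interval 2 (n ∸ 1)
    abscissas⊆interval x∈ with p , p∈ , refl ← ∈-map⁻ proj₁ x∈ with (2≤x , x≤n) , _ ← reentrant-inner p∈ =
      ∈-interval⁺ 2≤x (subst (λ m → proj₁ p < + m) (sym 2+[n∸1]≡1+n) (ℤ.≤-<-trans x≤n (+<+ (ℕ.n<1+n n))))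
    interval⊆abscissas : interval 2 (n ∸ 1) ⊆ map proj₁ R
    interval⊆abscissas { -[1+ _ ]} i∈ with () ← proj₁ (∈-interval⁻ i∈)
    interval⊆abscissas {+ i} i∈ with +≤+ 2≤i , +<+ i<2+[n∸1] ← ∈-interval⁻ i∈
      with p , p∈ , p≡i ← reentrant-with-coord vertical i 2≤i (ℕ.≤-pred (subst (i ℕ.<_) 2+[n∸1]≡1+n i<2+[n∸1]))
      = subst (_∈ map proj₁ R) p≡i (∈-map⁺ proj₁ p∈)

proposition2 : (n : ℕ) → 2 Data.Nat.≤ n →
    (P : Cells) (v₀ : Point) (w : Data.List.List Step) →
    Connected P → Convex P → BoundingBox n P →
    IsBoundaryWord P v₀ w → IsPermutomino n v₀ w →
    length (reentrantPoints v₀ w) ≡ n ∸ 1 ×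
    All (λ p → (+ 2 ≤ proj₁ p × proj₁ p ≤ + n) × (+ 2 ≤ proj₂ p × proj₂ p ≤ + n))
        (reentrantPoints v₀ w) ×
    ((i : ℕ) → 2 Data.Nat.≤ i → i Data.Nat.≤ n →
      length (filter (λ p → proj₁ p ≟ + i) (reentrantPoints v₀ w)) ≡ 1 ×
      length (filter (λ p → proj₂ p ≟ + i) (reentrantPoints v₀ w)) ≡ 1)
proposition2 n 2≤n P v₀ w connected convex box boundary perm
  with ss , refl ← boundaryWord-starts-north box boundary =
  let open ConvexPermutomino n (ℕ.≤-trans (ℕ.s≤s ℕ.z≤n) 2≤n) P v₀ ss connected convex box boundary perm
  in reentrants-length ,
     tabulate reentrant-inner ,
     λ i 2≤i i≤n → reentrants-on-line vertical i 2≤i i≤n , reentrants-on-line horizontal i 2≤i i≤n
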